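{- Let $G$ be a graph and $k$ an integer. There is a set $F\subseteq E(G)$ with $|F|\le k$ such that $G/F$ is a balanced biclique if and only if $V(G)$ has a $k$-constrained valid balanced partition.
   Context: All graphs are finite, simple and undirected. Contracting an edge $uv$ replaces $u,v$ by a new vertex adjacent to $(N(u)\cup N(v))\setminus\{u,v\}$; $G/F$ is obtained by contracting all edges of $F$. A biclique is a bipartite graph with bipartition $\langle X,Y\rangle$ in which every vertex of $X$ is adjacent to every vertex of $Y$ (edgeless graphs included); it is balanced if $|X|=|Y|$. For $S\subseteq V(G)$, $\mathsf{sf}(S)$ denotes the number of edges in a spanning forest of $G[S]$. A partition $\langle L,R\rangle$ of $V(G)$ into two parts is a $k$-constrained valid partition if (1) $\mathsf{sf}(L)+\mathsf{sf}(R)\le k$, and (2) every connected component of $G[L]$ is adjacent to every connected component of $G[R]$. It is a $k$-constrained valid balanced partition if additionally $G[L]$ and $G[R]$ have the same number of connected components. -}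

module Defs where

open import Data.Nat using (ℕ)
open import Data.Integer using (ℤ; +_; _+_; _≤_)
open import Data.Bool using (Bool; true; false; not)
open import Data.Fin using (Fin)
open import Data.Fin.Subset using (Subset; ∣_∣; ∁)
open import Data.Vec using (lookup)
open import Data.List using (List; length; removeAt) renaming (lookup to lookupL)
open import Data.List.Membership.Propositional using (_∈_)
open import Data.List.Relation.Unary.All using (All)
open import Data.Product using (Σ; ∃; ∃-syntax; _×_; _,_; proj₁; proj₂)
open import Relation.Nullary using (¬_)
open import Relation.Binary.PropositionalEquality using (_≡_; _≢_)
open import Relation.Binary.Construct.Closure.Equivalence using (EqClosure)
open import Function.Bundles using (_⇔_)

record Graph (n : ℕ) : Set where
  field
    adj   : Fin n → Fin n → Bool
    sym   : ∀ u v → adj u v ≡ adj v u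
    irrefl : ∀ v → adj v v ≡ false
open Graph public

-- An edge is an (ordered representative of an) unordered pair.
Edge : ℕ → Set
Edge n = Fin n × Fin n

IsEdge : ∀ {n} → Graph n → Edge n → Set
IsEdge G (u , v) = adj G u v ≡ true

EdgeIn : ∀ {n} → List (Edge n) → Fin n → Fin n → Set
EdgeIn T u v = (u , v) ∈ T

ConnBy : ∀ {n} → List (Edge n) → Fin n → Fin n → Set
ConnBy T = EqClosure (EdgeIn T)

-- The vertices of G/F are the connected components of (V(G), F);
-- a representation of G/F on Fin m is a surjection c : Fin n → Fin m
-- identifying exactly the F-connected vertices; two distinct vertices
-- of G/F are adjacent iff some edge of G joins the corresponding classes.

IsContractionMap : ∀ {n m} → List (Edge n) → (Fin n → Fin m) → Set
IsContractionMap {n} {m} F c =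
  (∀ (i : Fin m) → ∃[ u ] c u ≡ i) ×
  (∀ (u v : Fin n) → (c u ≡ c v) ⇔ ConnBy F u v)

ContrAdj : ∀ {n m} → Graph n → (Fin n → Fin m) → Fin m → Fin m → Set
ContrAdj G c i j = i ≢ j × ∃[ u ] ∃[ v ] (c u ≡ i × c v ≡ j × adj G u v ≡ true)

IsBalancedBiclique : ∀ {m} → (Fin m → Fin m → Set) → Set
IsBalancedBiclique {m} A =
  Σ (Subset m) λ X →
    (∣ X ∣ ≡ ∣ ∁ X ∣) ×
    (∀ i j → lookup X i ≡ lookup X j → ¬ A i j) ×
    (∀ i j → lookup X i ≢ lookup X j → A i j)

ContractionIsBalancedBiclique : ∀ {n} → Graph n → List (Edge n) → Set
ContractionIsBalancedBiclique {n} G F =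
  ∃[ m ] Σ (Fin n → Fin m) λ c →
    IsContractionMap F c × IsBalancedBiclique (ContrAdj G c)

-- Partitions ⟨L, R⟩ : L = {v | side v ≡ true}, R = {v | side v ≡ false}.

InducedAdj : ∀ {n} → Graph n → (Fin n → Bool) → Bool → Fin n → Fin n → Set
InducedAdj G side b u v = adj G u v ≡ true × side u ≡ b × side v ≡ b

InducedConn : ∀ {n} → Graph n → (Fin n → Bool) → Bool → Fin n → Fin n → Set
InducedConn G side b = EqClosure (InducedAdj G side b)

-- T is a forest: every edge of T is a bridge of (V, T), i.e. its ends
-- are not connected after removing it (this also forbids repeated edges).
IsForest : ∀ {n} → List (Edge n) → Set
IsForest T = ∀ (i : Fin (length T)) →
  let e = lookupL T i in
  ¬ ConnBy (removeAt T i) (proj₁ e) (proj₂ e)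

IsSpanningForest : ∀ {n} → Graph n → (Fin n → Bool) → Bool → List (Edge n) → Set
IsSpanningForest G side b T =
  All (λ e → InducedAdj G side b (proj₁ e) (proj₂ e)) T ×
  IsForest T ×
  (∀ u v → InducedConn G side b u v → ConnBy T u v)

-- G[S] has exactly c connected components: a system of representatives.
HasComponents : ∀ {n} → Graph n → (Fin n → Bool) → Bool → ℕ → Set
HasComponents {n} G side b c =
  Σ (Fin c → Fin n) λ rep →
    (∀ i → side (rep i) ≡ b) ×
    (∀ i j → InducedConn G side b (rep i) (rep j) → i ≡ j) ×
    (∀ u → side u ≡ b → ∃[ i ] InducedConn G side b u (rep i))

ValidPartition : ∀ {n} → Graph n → ℤ → (Fin n → Bool) → Set
ValidPartition G k side =
  (∃[ TL ] ∃[ TR ] (IsSpanningForest G side true TL ×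
                    IsSpanningForest G side false TR ×
                    (+ length TL) + (+ length TR) ≤ k)) ×
  (∀ u v → side u ≡ true → side v ≡ false →
     ∃[ u' ] ∃[ v' ] (InducedConn G side true u u' ×
                      InducedConn G side false v v' ×
                      adj G u' v' ≡ true))

ValidBalancedPartition : ∀ {n} → Graph n → ℤ → (Fin n → Bool) → Set
ValidBalancedPartition G k side =
  ValidPartition G k side ×
  ∃[ c ] (HasComponents G side true c × HasComponents G side false c)

{-# OPTIONS --safe #-}
module Submission where

open import Defs hiding (sym)
open import Data.Nat using (ℕ)
open import Data.Integer using (ℤ; +_; _≤_)
open import Data.Bool using (Bool)
open import Data.Fin using (Fin)
open import Data.List using (List; length)
open import Data.List.Relation.Unary.All using (All)
open import Data.Product using (Σ; ∃-syntax; _×_)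
open import Function.Bundles using (_⇔_)

import Data.Nat as ℕ
import Data.Nat.Properties as ℕ
import Data.Integer as ℤ
import Data.Integer.Properties as ℤ
open import Data.Bool using (true; false; not; if_then_else_)
import Data.Bool.Properties as Bool
open import Data.Fin using (zero; suc; _↑ˡ_; _↑ʳ_; splitAt)
import Data.Fin.Properties as Fin
open import Data.Fin.Subset using (Subset; ∣_∣; ∁; ⊤; ⊥)
open import Data.Fin.Subset.Properties using (∣⊥∣≡0; ∣∁p∣≡n∸∣p∣)
open import Data.Vec using (_∷_; _++_; lookup)
import Data.Vec.Properties as Vec
open import Data.List using ([]; _∷_; filter; removeAt) renaming (_++_ to _++ₗ_; lookup to lookupₗ)
import Data.List.Properties as List
open import Data.List.Membership.Propositional.Properties
  using (∈-lookup; ∈-++⁺ˡ; ∈-++⁺ʳ; ∈-++⁻; ∈-filter⁺; ∈-filter⁻)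
open import Data.List.Relation.Binary.Subset.Propositional using (_⊆_)
open import Data.List.Relation.Unary.Any using (here; there)
import Data.List.Relation.Unary.All as All
open import Data.Product using (_,_; proj₁; proj₂; ∃₂; swap)
import Data.Product as Product
open import Data.Sum using (_⊎_; inj₁; inj₂)
import Data.Sum as Sum
open import Data.Empty using (⊥-elim)
open import Function using (id; _∘_)
open import Function.Bundles using (mk⇔; Equivalence)
open import Level using (0ℓ)
open import Relation.Nullary using (¬_; yes; no; does)
open import Relation.Nullary.Decidable using (decidable-stable)
open import Relation.Binary using (Rel; IsEquivalence)
open import Relation.Binary.PropositionalEquality
  using (_≡_; _≢_; refl; sym; trans; cong; subst; subst₂; isEquivalence; module ≡-Reasoning)
import Relation.Binary.Construct.Closure.Equivalence as EC
open import Relation.Binary.Construct.Closure.ReflexiveTransitive using (ε; _◅_; _◅◅_)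
open import Relation.Binary.Construct.Closure.Symmetric using (fwd; bwd)

-- Both directions identify the vertices of G/F with the components of G[L] and of G[R].
-- From F: put v in L iff its class lies in the side X of the biclique. X being independent,
-- a component of G[L] meets a single class; a class is F-connected and lies on one side,
-- so the edges of F inside L (resp. R) connect it within G[L] (resp. G[R]). Hence the
-- components are exactly the classes, G[L] and G[R] have |X| = |∁ X| of them, and
-- spanning forests can be extracted from the edges of F inside L and inside R, giving
-- sf(L) + sf(R) ≤ |F|. Conversely, contracting the union of spanning forests of G[L] and
-- G[R] identifies exactly their components; validity makes every L-class adjacent to
-- every R-class, and no edge joins two classes on the same side.

true≢false : true ≢ false
true≢false ()

bool-≢ : ∀ {x y : Bool} → x ≢ y → (x ≡ true × y ≡ false) ⊎ (x ≡ false × y ≡ true)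
bool-≢ {true}  {false} _   = inj₁ (refl , refl)
bool-≢ {false} {true}  _   = inj₂ (refl , refl)
bool-≢ {true}  {true}  x≢y = ⊥-elim (x≢y refl)
bool-≢ {false} {false} x≢y = ⊥-elim (x≢y refl)

private
  symmetric : ∀ {A : Set} {R : Rel A 0ℓ} {x y} → EC.EqClosure R x y → EC.EqClosure R y x
  symmetric {R = R} = EC.symmetric R

eqClosure-fibre : ∀ {A B : Set} {R : Rel A 0ℓ} (f : A → B) → (∀ {x y} → R x y → f x ≡ f y) →
  ∀ {b x y} → EC.EqClosure R x y → f x ≡ b → EC.EqClosure (λ x y → R x y × f x ≡ b) x y
eqClosure-fibre f resp ε            fx = ε
eqClosure-fibre f resp (fwd r ◅ rs) fx =
  fwd (r , fx) ◅ eqClosure-fibre f resp rs (trans (sym (resp r)) fx)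
eqClosure-fibre f resp (bwd r ◅ rs) fx =
  bwd (r , trans (resp r) fx) ◅ eqClosure-fibre f resp rs (trans (resp r) fx)

length-filter-true+false : ∀ {A : Set} (f : A → Bool) (xs : List A) →
  length (filter (λ x → f x Bool.≟ true) xs) ℕ.+ length (filter (λ x → f x Bool.≟ false) xs)
    ≡ length xs
length-filter-true+false f [] = refl
length-filter-true+false f (x ∷ xs) with f x
... | true  = cong ℕ.suc (length-filter-true+false f xs)
... | false = trans (ℕ.+-suc _ _) (cong ℕ.suc (length-filter-true+false f xs))

removeAt-⊆ : ∀ {A : Set} (xs : List A) i → removeAt xs i ⊆ xs
removeAt-⊆ (x ∷ xs) zero    p         = there p
removeAt-⊆ (x ∷ xs) (suc i) (here p)  = here p
removeAt-⊆ (x ∷ xs) (suc i) (there p) = there (removeAt-⊆ xs i p)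

retarget : ∀ {n} → Fin n → Fin n → Fin n → Fin n
retarget from to l = if does (l Fin.≟ from) then to else l

retarget-≡ : ∀ {n} {from to l l′ : Fin n} → retarget from to l ≡ retarget from to l′ →
  l ≡ l′ ⊎ ((l ≡ to ⊎ l ≡ from) × (l′ ≡ to ⊎ l′ ≡ from))
retarget-≡ {from = from} {to} {l} {l′} eq with l Fin.≟ from | l′ Fin.≟ from
... | yes p | yes q = inj₂ (inj₂ p , inj₂ q)
... | yes p | no _  = inj₂ (inj₂ p , inj₁ (sym eq))
... | no _  | yes q = inj₂ (inj₁ eq , inj₂ q)
... | no _  | no _  = inj₁ eq

retarget-from : ∀ {n} {from to : Fin n} → retarget from to from ≡ to
retarget-from {from = from} with from Fin.≟ from
... | yes _    = refl
... | no f≢f = ⊥-elim (f≢f refl)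

retarget-other : ∀ {n} {from to l : Fin n} → l ≢ from → retarget from to l ≡ l
retarget-other {from = from} {l = l} l≢f with l Fin.≟ from
... | yes l≡f = ⊥-elim (l≢f l≡f)
... | no _    = refl

module _ {n : ℕ} where

  connBy-mono : {S T : List (Edge n)} → S ⊆ T → ∀ {u v} → ConnBy S u v → ConnBy T u v
  connBy-mono S⊆T = EC.map S⊆T

  module _ (S : List (Edge n)) (a b : Fin n) where

    Touches : Fin n → Set
    Touches x = ConnBy S x a ⊎ ConnBy S x b

    ConnVia : Fin n → Fin n → Set
    ConnVia x y = ConnBy S x y ⊎ (Touches x × Touches y)

    private
      touches-resp : ∀ {x y} → ConnBy S x y → Touches y → Touches x
      touches-resp p = Sum.map (p ◅◅_) (p ◅◅_)

      connVia-trans : ∀ {x y z} → ConnVia x y → ConnVia y z → ConnVia x z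
      connVia-trans (inj₁ p)        (inj₁ q)        = inj₁ (p ◅◅ q)
      connVia-trans (inj₁ p)        (inj₂ (ty , tz)) = inj₂ (touches-resp p ty , tz)
      connVia-trans (inj₂ (tx , ty)) (inj₁ q)        = inj₂ (tx , touches-resp (symmetric q) ty)
      connVia-trans (inj₂ (tx , _)) (inj₂ (_ , tz))  = inj₂ (tx , tz)

      connVia-isEquivalence : IsEquivalence ConnVia
      connVia-isEquivalence = record
        { refl  = inj₁ ε
        ; sym   = Sum.map symmetric swap
        ; trans = connVia-trans
        }

    connBy-∷⁻ : ∀ {x y} → ConnBy ((a , b) ∷ S) x y → ConnVia x y
    connBy-∷⁻ = EC.fold connVia-isEquivalence edge
      where
      edge : ∀ {x y} → EdgeIn ((a , b) ∷ S) x y → ConnVia x y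
      edge (here refl) = inj₂ (inj₁ ε , inj₂ ε)
      edge (there e)   = inj₁ (EC.return e)

    connBy-∷⁺ : ∀ {x y} → ConnVia x y → ConnBy ((a , b) ∷ S) x y
    connBy-∷⁺ (inj₁ p)         = connBy-mono there p
    connBy-∷⁺ (inj₂ (tx , ty)) = toA tx ◅◅ symmetric (toA ty)
      where
      toA : ∀ {x} → Touches x → ConnBy ((a , b) ∷ S) x a
      toA (inj₁ xa) = connBy-mono there xa
      toA (inj₂ xb) = connBy-mono there xb ◅◅ symmetric (EC.return (here refl))

  isForest-∷ : ∀ {T : List (Edge n)} {a b} → IsForest T → ¬ ConnBy T a b → IsForest ((a , b) ∷ T)
  isForest-∷ forest a≁b zero = a≁b
  isForest-∷ {T} {a} {b} forest a≁b (suc i) = closes-cycle ∘ connBy-∷⁻ (removeAt T i) a b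
    where
    x = proj₁ (lookupₗ T i)
    y = proj₂ (lookupₗ T i)
    lift : ∀ {u v} → ConnBy (removeAt T i) u v → ConnBy T u v
    lift = connBy-mono (removeAt-⊆ T i)
    xy : ConnBy T x y
    xy = EC.return (∈-lookup i)
    closes-cycle : ¬ ConnVia (removeAt T i) a b x y
    closes-cycle (inj₁ x~y)                 = forest i x~y
    closes-cycle (inj₂ (inj₁ x~a , inj₁ y~a)) = forest i (x~a ◅◅ symmetric y~a)
    closes-cycle (inj₂ (inj₂ x~b , inj₂ y~b)) = forest i (x~b ◅◅ symmetric y~b)
    closes-cycle (inj₂ (inj₁ x~a , inj₂ y~b)) =
      a≁b (symmetric (lift x~a) ◅◅ xy ◅◅ lift y~b)
    closes-cycle (inj₂ (inj₂ x~b , inj₁ y~a)) =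
      a≁b (symmetric (lift y~a) ◅◅ symmetric xy ◅◅ lift x~b)

  -- label u ≡ label v decides connectivity in edges, which lets the greedy step test for cycles.
  record SpanningSubforest (F : List (Edge n)) : Set where
    field
      edges            : List (Edge n)
      label            : Fin n → Fin n
      edges⊆           : edges ⊆ F
      shorter          : length edges ℕ.≤ length F
      isForest         : IsForest edges
      label-resp-edges : ∀ {x y} → EdgeIn edges x y → label x ≡ label y
      label⇒connBy     : ∀ u v → label u ≡ label v → ConnBy edges u v
      spans            : ∀ {x y} → EdgeIn F x y → ConnBy edges x y

    connBy⇒label : ∀ {u v} → ConnBy edges u v → label u ≡ label v
    connBy⇒label = EC.gfold isEquivalence label label-resp-edges

    connBy-spans : ∀ {u v} → ConnBy F u v → ConnBy edges u v
    connBy-spans = EC.fold (EC.isEquivalence _) spans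

  spanningSubforest : (F : List (Edge n)) → SpanningSubforest F
  spanningSubforest [] = record
    { edges = [] ; label = id ; edges⊆ = λ () ; shorter = ℕ.z≤n ; isForest = λ ()
    ; label-resp-edges = λ ()
    ; label⇒connBy = λ u v u≡v → subst (ConnBy [] u) u≡v ε
    ; spans = λ () }
  spanningSubforest ((a , b) ∷ F) with spanningSubforest F
  ... | T with SpanningSubforest.label T a Fin.≟ SpanningSubforest.label T b
  ... | yes ab = record
    { SpanningSubforest T
    ; edges⊆  = there ∘ edges⊆
    ; shorter = ℕ.m≤n⇒m≤1+n shorter
    ; spans   = λ { (here refl) → label⇒connBy a b ab ; (there e) → spans e } }
    where open SpanningSubforest T
  ... | no a≁b = record
    { edges    = (a , b) ∷ edges
    ; label    = label′
    ; edges⊆   = λ { (here e) → here e ; (there e) → there (edges⊆ e) }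
    ; shorter  = ℕ.s≤s shorter
    ; isForest = isForest-∷ isForest (a≁b ∘ connBy⇒label)
    ; label-resp-edges = λ { (here refl) → new-edge ; (there e) → cong merge (label-resp-edges e) }
    ; label⇒connBy = λ u v → connBy-∷⁺ edges a b ∘ Sum.map (label⇒connBy u v)
        (Product.map (Sum.map (label⇒connBy u a) (label⇒connBy u b))
                     (Sum.map (label⇒connBy v a) (label⇒connBy v b))) ∘ retarget-≡
    ; spans = λ { (here refl) → EC.return (here refl) ; (there e) → connBy-mono there (spans e) } }
    where
    open SpanningSubforest T
    merge : Fin n → Fin n
    merge = retarget (label b) (label a)
    label′ : Fin n → Fin n
    label′ = merge ∘ label
    new-edge : label′ a ≡ label′ b
    new-edge = trans (retarget-other a≁b) (sym (retarget-from {from = label b}))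

enumerate : ∀ {m} (p : Subset m) → Fin ∣ p ∣ → Fin m
enumerate (true  ∷ p) zero    = zero
enumerate (true  ∷ p) (suc j) = suc (enumerate p j)
enumerate (false ∷ p) j       = suc (enumerate p j)

lookup-enumerate : ∀ {m} (p : Subset m) j → lookup p (enumerate p j) ≡ true
lookup-enumerate (true  ∷ p) zero    = refl
lookup-enumerate (true  ∷ p) (suc j) = lookup-enumerate p j
lookup-enumerate (false ∷ p) j       = lookup-enumerate p j

enumerate-injective : ∀ {m} (p : Subset m) {i j} → enumerate p i ≡ enumerate p j → i ≡ j
enumerate-injective (true  ∷ p) {zero}  {zero}  eq = refl
enumerate-injective (true  ∷ p) {suc i} {suc j} eq = cong suc (enumerate-injective p (Fin.suc-injective eq))
enumerate-injective (false ∷ p)                 eq = enumerate-injective p (Fin.suc-injective eq)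

enumerate-surjective : ∀ {m} (p : Subset m) i → lookup p i ≡ true → ∃[ j ] enumerate p j ≡ i
enumerate-surjective (true  ∷ p) zero    _  = zero , refl
enumerate-surjective (true  ∷ p) (suc i) pi = Product.map suc (cong suc) (enumerate-surjective p i pi)
enumerate-surjective (false ∷ p) (suc i) pi = Product.map₂ (cong suc) (enumerate-surjective p i pi)

module _ (c : ℕ) where

  embed : Bool → Fin c → Fin (c ℕ.+ c)
  embed true  j = j ↑ˡ c
  embed false j = c ↑ʳ j

  embed-injective : ∀ b {i j} → embed b i ≡ embed b j → i ≡ j
  embed-injective true  = Fin.↑ˡ-injective c _ _
  embed-injective false = Fin.↑ʳ-injective c _ _

  embed-surjective : ∀ i → ∃₂ λ b j → embed b j ≡ i
  embed-surjective i with splitAt c i in eq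
  ... | inj₁ j = true  , j , Fin.splitAt⁻¹-↑ˡ eq
  ... | inj₂ j = false , j , Fin.splitAt⁻¹-↑ʳ eq

  halves : Subset (c ℕ.+ c)
  halves = ⊤ {c} ++ ⊥ {c}

  lookup-halves : ∀ b j → lookup halves (embed b j) ≡ b
  lookup-halves true  j = trans (Vec.lookup-++ˡ (⊤ {c}) (⊥ {c}) j) (Vec.lookup-replicate j true)
  lookup-halves false j = trans (Vec.lookup-++ʳ (⊤ {c}) (⊥ {c}) j) (Vec.lookup-replicate j false)

  halves-balanced : ∣ halves ∣ ≡ ∣ ∁ halves ∣
  halves-balanced = begin
    ∣ halves ∣            ≡⟨ ∣⊤++⊥∣ c ⟩
    c                     ≡⟨ ℕ.m+n∸n≡m c c ⟨
    c ℕ.+ c ℕ.∸ c         ≡⟨ cong (c ℕ.+ c ℕ.∸_) (∣⊤++⊥∣ c) ⟨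
    c ℕ.+ c ℕ.∸ ∣ halves ∣ ≡⟨ ∣∁p∣≡n∸∣p∣ halves ⟨
    ∣ ∁ halves ∣          ∎
    where
    open ≡-Reasoning
    ∣⊤++⊥∣ : ∀ a → ∣ ⊤ {a} ++ ⊥ {c} ∣ ≡ a
    ∣⊤++⊥∣ ℕ.zero    = ∣⊥∣≡0 c
    ∣⊤++⊥∣ (ℕ.suc a) = cong ℕ.suc (∣⊤++⊥∣ a)

module ComponentIndex {n c} {G : Graph n} {side : Fin n → Bool} {b : Bool}
  (components : HasComponents G side b c) where

  rep : Fin c → Fin n
  rep = proj₁ components

  rep-side : ∀ j → side (rep j) ≡ b
  rep-side = proj₁ (proj₂ components)

  index : ∀ u → side u ≡ b → Fin c
  index u su = proj₁ (proj₂ (proj₂ (proj₂ components)) u su)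

  index-conn : ∀ u su → InducedConn G side b u (rep (index u su))
  index-conn u su = proj₂ (proj₂ (proj₂ (proj₂ components)) u su)

  index-unique : ∀ {u} su {j} → InducedConn G side b u (rep j) → index u su ≡ j
  index-unique su q = proj₁ (proj₂ (proj₂ components)) _ _ (symmetric (index-conn _ su) ◅◅ q)

  sameIndex⇒conn : ∀ {u v} su sv → index u su ≡ index v sv → InducedConn G side b u v
  sameIndex⇒conn {u} {v} su sv eq = index-conn u su ◅◅
    subst (λ j → InducedConn G side b (rep j) v) (sym eq) (symmetric (index-conn v sv))

contrAdj-sym : ∀ {n m} (G : Graph n) (c : Fin n → Fin m) {i j} → ContrAdj G c i j → ContrAdj G c j i
contrAdj-sym G c (i≢j , u , v , cu , cv , uv) = i≢j ∘ sym , v , u , cv , cu , trans (Graph.sym G v u) uv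

ComponentsAdjacent : ∀ {n} → Graph n → (Fin n → Bool) → Set
ComponentsAdjacent G side = ∀ u v → side u ≡ true → side v ≡ false →
  ∃[ u′ ] ∃[ v′ ] (InducedConn G side true u u′ × InducedConn G side false v v′ × adj G u′ v′ ≡ true)

module FromContraction {n m} (G : Graph n) (F : List (Edge n)) (F⊆E : All (IsEdge G) F)
  (c : Fin n → Fin m) (contraction : IsContractionMap F c) (X : Subset m)
  (independent : ∀ i j → lookup X i ≡ lookup X j → ¬ ContrAdj G c i j)
  (complete : ∀ i j → lookup X i ≢ lookup X j → ContrAdj G c i j) where

  side : Fin n → Bool
  side v = lookup X (c v)

  sameClass⇒connBy : ∀ {u v} → c u ≡ c v → ConnBy F u v
  sameClass⇒connBy = Equivalence.to (proj₂ contraction _ _)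

  connBy⇒sameClass : ∀ {u v} → ConnBy F u v → c u ≡ c v
  connBy⇒sameClass = Equivalence.from (proj₂ contraction _ _)

  inducedAdj⇒sameClass : ∀ {b x y} → InducedAdj G side b x y → c x ≡ c y
  inducedAdj⇒sameClass {x = x} {y} (xy , sx , sy) = decidable-stable (c x Fin.≟ c y)
    λ cx≢cy → independent (c x) (c y) (trans sx (sym sy)) (cx≢cy , x , y , refl , refl , xy)

  inducedConn⇒sameClass : ∀ {b x y} → InducedConn G side b x y → c x ≡ c y
  inducedConn⇒sameClass = EC.gfold isEquivalence c inducedAdj⇒sameClass

  F-sameSide : ∀ {x y} → EdgeIn F x y → side x ≡ side y
  F-sameSide = cong (lookup X) ∘ connBy⇒sameClass ∘ EC.return

  edgesOn : Bool → List (Edge n)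
  edgesOn b = filter (λ e → side (proj₁ e) Bool.≟ b) F

  edgesOn-inducedAdj : ∀ {b x y} → EdgeIn (edgesOn b) x y → InducedAdj G side b x y
  edgesOn-inducedAdj e with ∈-filter⁻ _ e
  ... | e∈F , sx = All.lookup F⊆E e∈F , sx , trans (sym (F-sameSide e∈F)) sx

  sameClass⇒connByOn : ∀ {b u v} → c u ≡ c v → side u ≡ b → ConnBy (edgesOn b) u v
  sameClass⇒connByOn cu≡cv su = EC.map (λ (e , sx) → ∈-filter⁺ _ e sx)
    (eqClosure-fibre side F-sameSide (sameClass⇒connBy cu≡cv) su)

  sameClass⇒inducedConn : ∀ {b u v} → c u ≡ c v → side u ≡ b → InducedConn G side b u v
  sameClass⇒inducedConn cu≡cv su = EC.map edgesOn-inducedAdj (sameClass⇒connByOn cu≡cv su)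

  spanningForestOn : (b : Bool) →
    ∃[ T ] (IsSpanningForest G side b T × length T ℕ.≤ length (edgesOn b))
  spanningForestOn b =
    edges , (All.tabulate (edgesOn-inducedAdj ∘ edges⊆) , isForest , spansInduced) , shorter
    where
    open SpanningSubforest (spanningSubforest (edgesOn b))
    spansAdj : ∀ {x y} → InducedAdj G side b x y → ConnBy edges x y
    spansAdj xy@(_ , sx , _) = connBy-spans (sameClass⇒connByOn (inducedAdj⇒sameClass xy) sx)
    spansInduced : ∀ u v → InducedConn G side b u v → ConnBy edges u v
    spansInduced _ _ = EC.fold (EC.isEquivalence _) spansAdj

  classesOn : Bool → Subset m
  classesOn true  = X
  classesOn false = ∁ X

  lookup-classesOn : ∀ b i → lookup (classesOn b) i ≡ true ⇔ lookup X i ≡ b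
  lookup-classesOn true  i = mk⇔ id id
  lookup-classesOn false i rewrite Vec.lookup-map i not X with lookup X i
  ... | true  = mk⇔ (λ ()) (λ ())
  ... | false = mk⇔ (λ _ → refl) (λ _ → refl)

  hasComponents : (b : Bool) → HasComponents G side b ∣ classesOn b ∣
  hasComponents b = rep , rep-side , rep-injective , cover
    where
    p = classesOn b
    rep : Fin ∣ p ∣ → Fin n
    rep j = proj₁ (proj₁ contraction (enumerate p j))
    c-rep : ∀ j → c (rep j) ≡ enumerate p j
    c-rep j = proj₂ (proj₁ contraction (enumerate p j))
    rep-side : ∀ j → side (rep j) ≡ b
    rep-side j = Equivalence.to (lookup-classesOn b _)
      (subst (λ i → lookup p i ≡ true) (sym (c-rep j)) (lookup-enumerate p j))
    rep-injective : ∀ i j → InducedConn G side b (rep i) (rep j) → i ≡ j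
    rep-injective i j q =
      enumerate-injective p (trans (sym (c-rep i)) (trans (inducedConn⇒sameClass q) (c-rep j)))
    cover : ∀ u → side u ≡ b → ∃[ j ] InducedConn G side b u (rep j)
    cover u su with enumerate-surjective p (c u) (Equivalence.from (lookup-classesOn b _) su)
    ... | j , eq = j , sameClass⇒inducedConn (trans (sym eq) (sym (c-rep j))) su

  crossing : ComponentsAdjacent G side
  crossing u v su sv with complete (c u) (c v) (λ eq → true≢false (trans (sym su) (trans eq sv)))
  ... | _ , u′ , v′ , cu′ , cv′ , u′v′ =
    u′ , v′ , sameClass⇒inducedConn (sym cu′) su , sameClass⇒inducedConn (sym cv′) sv , u′v′

  validBalancedPartition : ∀ {k} → (+ length F) ≤ k → ∣ X ∣ ≡ ∣ ∁ X ∣ →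
    ValidBalancedPartition G k side
  validBalancedPartition F≤k balanced with spanningForestOn true | spanningForestOn false
  ... | TL , TL-spanning , TL≤ | TR , TR-spanning , TR≤ =
    ((TL , TR , TL-spanning , TR-spanning , ℤ.≤-trans (ℤ.+≤+ forests≤F) F≤k) , crossing) ,
    ∣ X ∣ , hasComponents true , subst (HasComponents G side false) (sym balanced) (hasComponents false)
    where
    forests≤F : length TL ℕ.+ length TR ℕ.≤ length F
    forests≤F = ℕ.≤-trans (ℕ.+-mono-≤ TL≤ TR≤)
                          (ℕ.≤-reflexive (length-filter-true+false (side ∘ proj₁) F))

module FromPartition {n} (G : Graph n) (side : Fin n → Bool) (TL TR : List (Edge n))
  (TL-spanning : IsSpanningForest G side true TL) (TR-spanning : IsSpanningForest G side false TR)
  (crossing : ComponentsAdjacent G side) (cnt : ℕ)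
  (L-components : HasComponents G side true cnt) (R-components : HasComponents G side false cnt) where

  F : List (Edge n)
  F = TL ++ₗ TR

  forest : Bool → List (Edge n)
  forest true  = TL
  forest false = TR

  forest-spanning : ∀ b → IsSpanningForest G side b (forest b)
  forest-spanning true  = TL-spanning
  forest-spanning false = TR-spanning

  forest-spans : ∀ b u v → InducedConn G side b u v → ConnBy (forest b) u v
  forest-spans b = proj₂ (proj₂ (forest-spanning b))

  forest⊆F : ∀ b → forest b ⊆ F
  forest⊆F true  = ∈-++⁺ˡ
  forest⊆F false = ∈-++⁺ʳ TL

  F-inducedAdj : ∀ {x y} → EdgeIn F x y → Σ Bool λ b → InducedAdj G side b x y
  F-inducedAdj e with ∈-++⁻ TL e
  ... | inj₁ e∈TL = true  , All.lookup (proj₁ TL-spanning) e∈TL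
  ... | inj₂ e∈TR = false , All.lookup (proj₁ TR-spanning) e∈TR

  F⊆E : All (IsEdge G) F
  F⊆E = All.tabulate (proj₁ ∘ proj₂ ∘ F-inducedAdj)

  components : ∀ b → HasComponents G side b cnt
  components true  = L-components
  components false = R-components

  module Index (b : Bool) = ComponentIndex {G = G} {side = side} (components b)
  open Index

  -- The vertices of G/F: components of G[L] in the first copy of Fin cnt, of G[R] in the second.
  classOf : Fin n → Fin (cnt ℕ.+ cnt)
  classOf u = embed cnt (side u) (index (side u) u refl)

  classOf-≡ : ∀ {u b} (su : side u ≡ b) → classOf u ≡ embed cnt b (index b u su)
  classOf-≡ refl = refl

  lookup-halves-classOf : ∀ u → lookup (halves cnt) (classOf u) ≡ side u
  lookup-halves-classOf u = lookup-halves cnt (side u) _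

  sameClass⇒sameSide : ∀ {u v} → classOf u ≡ classOf v → side u ≡ side v
  sameClass⇒sameSide {u} {v} eq =
    subst₂ _≡_ (lookup-halves-classOf u) (lookup-halves-classOf v) (cong (lookup (halves cnt)) eq)

  inducedAdj⇒sameClass : ∀ {b x y} → InducedAdj G side b x y → classOf x ≡ classOf y
  inducedAdj⇒sameClass {b} {x} {y} xy@(_ , sx , sy) = begin
    classOf x                  ≡⟨ classOf-≡ sx ⟩
    embed cnt b (index b x sx) ≡⟨ cong (embed cnt b) (index-unique b sx x~rep) ⟩
    embed cnt b (index b y sy) ≡⟨ classOf-≡ sy ⟨
    classOf y                  ∎
    where
    open ≡-Reasoning
    x~rep : InducedConn G side b x (rep b (index b y sy))
    x~rep = EC.return xy ◅◅ index-conn b y sy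

  inducedConn⇒sameClass : ∀ {b x y} → InducedConn G side b x y → classOf x ≡ classOf y
  inducedConn⇒sameClass = EC.gfold isEquivalence classOf inducedAdj⇒sameClass

  sameClass⇒inducedConn : ∀ {u v} → classOf u ≡ classOf v → InducedConn G side (side u) u v
  sameClass⇒inducedConn {u} {v} eq = sameIndex⇒conn (side u) refl sv
    (embed-injective cnt (side u) (trans eq (classOf-≡ sv)))
    where
    sv : side v ≡ side u
    sv = sym (sameClass⇒sameSide eq)

  classOf-rep : ∀ b j → classOf (rep b j) ≡ embed cnt b j
  classOf-rep b j = trans (classOf-≡ (rep-side b j)) (cong (embed cnt b) (index-unique b _ ε))

  classOf-surjective : ∀ i → ∃[ u ] classOf u ≡ i
  classOf-surjective i with embed-surjective cnt i
  ... | b , j , refl = rep b j , classOf-rep b j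

  isContractionMap : IsContractionMap F classOf
  isContractionMap = classOf-surjective , λ u v → mk⇔ (sameClass⇒connBy u v) connBy⇒sameClass
    where
    sameClass⇒connBy : ∀ u v → classOf u ≡ classOf v → ConnBy F u v
    sameClass⇒connBy u v =
      connBy-mono (forest⊆F (side u)) ∘ forest-spans (side u) u v ∘ sameClass⇒inducedConn
    connBy⇒sameClass : ∀ {u v} → ConnBy F u v → classOf u ≡ classOf v
    connBy⇒sameClass = EC.gfold isEquivalence classOf (inducedAdj⇒sameClass ∘ proj₂ ∘ F-inducedAdj)

  independent : ∀ i j → lookup (halves cnt) i ≡ lookup (halves cnt) j → ¬ ContrAdj G classOf i j
  independent _ _ eq (i≢j , u , v , refl , refl , uv) = i≢j (inducedAdj⇒sameClass (uv , refl , sv))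
    where
    sv : side v ≡ side u
    sv = subst₂ _≡_ (lookup-halves-classOf v) (lookup-halves-classOf u) (sym eq)

  crossingAdj : ∀ u v → side u ≡ true → side v ≡ false →
    ContrAdj G classOf (classOf u) (classOf v)
  crossingAdj u v su sv with crossing u v su sv
  ... | u′ , v′ , uu′ , vv′ , u′v′ =
    (λ eq → true≢false (trans (sym su) (trans (sameClass⇒sameSide eq) sv))) ,
    u′ , v′ , sym (inducedConn⇒sameClass uu′) , sym (inducedConn⇒sameClass vv′) , u′v′

  complete : ∀ i j → lookup (halves cnt) i ≢ lookup (halves cnt) j → ContrAdj G classOf i j
  complete i j ne with classOf-surjective i | classOf-surjective j
  ... | u , refl | v , refl
    with bool-≢ (subst₂ _≢_ (lookup-halves-classOf u) (lookup-halves-classOf v) ne)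
  ... | inj₁ (su , sv) = crossingAdj u v su sv
  ... | inj₂ (su , sv) = contrAdj-sym G classOf (crossingAdj v u sv su)

  contractionIsBalancedBiclique : ContractionIsBalancedBiclique G F
  contractionIsBalancedBiclique =
    cnt ℕ.+ cnt , classOf , isContractionMap , halves cnt , halves-balanced cnt , independent , complete

lemma3 : ∀ {n} (G : Graph n) (k : ℤ) →
    (∃[ F ] (All (IsEdge G) F × (+ length F) ≤ k × ContractionIsBalancedBiclique G F))
      ⇔ (∃[ side ] ValidBalancedPartition G k side)
lemma3 G k = mk⇔
  (λ (F , F⊆E , F≤k , _ , c , contraction , X , balanced , independent , complete) →
     let open FromContraction G F F⊆E c contraction X independent complete in
     side , validBalancedPartition F≤k balanced)
  (λ (side , ((TL , TR , TL-spanning , TR-spanning , forests≤k) , crossing) ,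
        cnt , L-components , R-components) →
     let open FromPartition G side TL TR TL-spanning TR-spanning crossing cnt L-components R-components in
     F , F⊆E , subst (λ l → + l ≤ k) (sym (List.length-++ TL)) forests≤k , contractionIsBalancedBiclique)
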